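{- Let $G$ be a finite simple graph, $k$ a positive integer, and $P,Q$ distinct stable $k$-partitions of $G$. If $P-v=Q-v$ and $P-w=Q-w$ for distinct vertices $v,w\in V(G)$, then $v$ and $w$ are nonadjacent in $G$, and $P=\{\{v,w\},\emptyset\}\cup R$ and $Q=\{\{v\},\{w\}\}\cup R$ for some multiset $R$ consisting of $k-2$ independent sets.
   Context: A stable $k$-partition of $G$ is a multiset $P=\{V_1,\dots,V_k\}$ of $k$ independent sets of $G$ (some possibly empty) that partition $V(G)$. For $v\in V(G)$, $P-v$ denotes the multiset $\{V_i\setminus\{v\}:1\le i\le k\}$. Partitions are unordered multisets of parts, and $\cup$ denotes multiset union. -}

module Defs where

open import Data.Nat using (ℕ)
open import Data.Fin using (Fin)
open import Data.Fin.Subset using (Subset; _∈_; _-_; ⁅_⁆; _∪_; ⊥)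
open import Data.List using (List; length; map; lookup; _∷_)
open import Data.List.Relation.Unary.All using (All)
open import Data.Product using (Σ; ∃; _×_)
open import Relation.Nullary using (¬_)
open import Relation.Binary.PropositionalEquality using (_≡_)

record Graph (n : ℕ) : Set₁ where
  field
    Adj     : Fin n → Fin n → Set
    sym     : ∀ {x y} → Adj x y → Adj y x
    irrefl  : ∀ x → ¬ Adj x x
open Graph public

Independent : ∀ {n} → Graph n → Subset n → Set
Independent G S = ∀ x y → x ∈ S → y ∈ S → ¬ Adj G x y

-- A multiset of subsets is represented by a list, compared up to
-- permutation (Data.List.Relation.Binary.Permutation.Propositional._↭_).

-- P partitions V(G): every vertex lies in exactly one of the parts
-- (counted with multiplicity as list positions).
Partitions : ∀ {n} → List (Subset n) → Set
Partitions {n} P =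
  ∀ (x : Fin n) → Σ (Fin (length P)) λ i →
    (x ∈ lookup P i) × (∀ j → x ∈ lookup P j → j ≡ i)

StablePartition : ∀ {n} → Graph n → ℕ → List (Subset n) → Set
StablePartition G k P = (length P ≡ k) × All (Independent G) P × Partitions P

_minus_ : ∀ {n} → List (Subset n) → Fin n → List (Subset n)
P minus v = map (λ S → S - v) P

{-# OPTIONS --safe #-}
module Submission where

-- Let p and q be the parts of P and Q containing v. Since P - v and Q - v
-- agree as multisets, either p = q (and then P = Q), or P = {p, q - v} ∪ T and
-- Q = {q, p - v} ∪ T: Q arises from P by moving v from p into q - v.
-- Deleting w from these descriptions and cancelling T forces p - w = q - w.
-- If w lies in both or neither of p and q, then p = q again. Otherwise, say
-- w ∈ p ∖ q; then any x ∈ q other than v would lie in p - w = q - w and in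
-- the part q - v of P, contradicting disjointness. Hence q = {v}, p = {v, w},
-- and v, w are non-adjacent because p is independent.

open import Defs hiding (sym)
open import Data.Nat using (ℕ; _≤_; _+_)
open import Data.Nat.Properties using (+-comm)
open import Data.Fin using (Fin; zero; suc; _≟_)
open import Data.Vec using (_∷_; there)
open import Data.Fin.Subset using (Subset; _∈_; _∉_; _⊆_; _-_; ⁅_⁆; _∪_; ⊥)
open import Data.Fin.Subset.Properties
  using ( _∈?_; ⊆-antisym; ⊆-reflexive; p─q⊆p; x∈p∧x≢y⇒x∈p-y; x∈⁅x⁆; x∈⁅y⁆⇒x≡y
        ; x∈p∪q⁺; x∈p∪q⁻; Empty-unique)
open import Data.List using (List; []; _∷_; _++_; length; lookup)
open import Data.List.Properties as List using (tabulate-lookup)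
open import Data.List.Relation.Unary.All as All using (All; []; _∷_)
open import Data.List.Relation.Unary.AllPairs using (AllPairs; _∷_)
open import Data.List.Relation.Unary.AllPairs.Properties using (tabulate⁺)
open import Data.List.Relation.Unary.Any using (here; there)
open import Data.List.Membership.Propositional using () renaming (_∈_ to _∈ˡ_)
open import Data.List.Membership.Propositional.Properties using (∈-∃++; ∈-lookup)
open import Data.List.Relation.Binary.Permutation.Propositional
  using (_↭_; refl; prep; swap; ↭-sym; ↭-trans; ↭⇒↭ₛ; module PermutationReasoning)
open import Data.List.Relation.Binary.Permutation.Propositional.Properties
  using (shift; drop-mid; drop-∷; ∈-resp-↭; map⁺; ↭-length; All-resp-↭; ↭-singleton-inv)
import Data.List.Relation.Binary.Permutation.Setoid.Properties as PermutationSetoid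
open import Data.Product using (Σ; ∃; ∃₂; _×_; _,_)
open import Data.Sum using (_⊎_; inj₁; inj₂; [_,_])
open import Data.Empty using (⊥-elim)
open import Function using (_∘_; const)
open import Function.Bundles using (_⇔_; mk⇔; Equivalence)
open import Level using (Level)
open import Relation.Binary.Core using (Rel)
open import Relation.Binary.Definitions using (Symmetric; _Respects_)
open import Relation.Nullary using (¬_; yes; no)
open import Relation.Binary.PropositionalEquality
  using (_≡_; _≢_; refl; sym; trans; cong₂; subst; subst₂; setoid; resp₂)

private
  variable
    ℓ : Level
    A : Set
    a b c d x y : A
    xs ys zs : List A
    n : ℕ

∈⇒↭∷ : x ∈ˡ xs → ∃ λ ys → xs ↭ x ∷ ys
∈⇒↭∷ x∈xs with as , bs , refl ← ∈-∃++ x∈xs = as ++ bs , shift _ as bs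

∷-↭-∷⁻ : x ∷ xs ↭ y ∷ ys →
  (x ≡ y × xs ↭ ys) ⊎ (∃ λ zs → xs ↭ y ∷ zs × ys ↭ x ∷ zs)
∷-↭-∷⁻ {x = x} {xs = xs} {y = y} {ys = ys} x∷xs↭y∷ys
  with ∈-resp-↭ (↭-sym x∷xs↭y∷ys) (here refl)
... | here refl = inj₁ (refl , drop-∷ x∷xs↭y∷ys)
... | there y∈xs with zs , xs↭y∷zs ← ∈⇒↭∷ y∈xs =
  inj₂ (zs , xs↭y∷zs , drop-∷ y∷ys↭y∷x∷zs)
  where
  open PermutationReasoning
  y∷ys↭y∷x∷zs : y ∷ ys ↭ y ∷ x ∷ zs
  y∷ys↭y∷x∷zs = begin
    y ∷ ys      ↭⟨ ↭-sym x∷xs↭y∷ys ⟩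
    x ∷ xs      ↭⟨ prep x xs↭y∷zs ⟩
    x ∷ y ∷ zs  ↭⟨ swap x y refl ⟩
    y ∷ x ∷ zs  ∎

++-cancelʳ : ∀ zs → xs ++ zs ↭ ys ++ zs → xs ↭ ys
++-cancelʳ {xs = xs} {ys = ys} [] p =
  subst₂ _↭_ (List.++-identityʳ xs) (List.++-identityʳ ys) p
++-cancelʳ {xs = xs} {ys = ys} (_ ∷ zs) p = ++-cancelʳ zs (drop-mid xs ys p)

pair-↭-pair⁻ : a ∷ b ∷ [] ↭ c ∷ d ∷ [] → (a ≡ c × b ≡ d) ⊎ (a ≡ d × b ≡ c)
pair-↭-pair⁻ p with ∷-↭-∷⁻ p
... | inj₁ (refl , b↭d) with refl ← ↭-singleton-inv b↭d = inj₁ (refl , refl)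
... | inj₂ (_ , b↭c∷zs , d↭a∷zs)
  with refl ← ↭-singleton-inv (↭-sym b↭c∷zs)
     | refl ← ↭-singleton-inv (↭-sym d↭a∷zs) = inj₂ (refl , refl)

AllPairs-resp-↭ : {R : Rel A ℓ} → Symmetric R → AllPairs R Respects _↭_
AllPairs-resp-↭ {A = A} {R = R} R-sym xs↭ys =
  PermutationSetoid.AllPairs-resp-↭ (setoid A) R-sym (resp₂ R) (↭⇒↭ₛ xs↭ys)

private
  variable
    p q : Subset n
    v w : Fin n

x∈p-y⇒x≢y : x ∈ p - y → x ≢ y
x∈p-y⇒x≢y {x = zero} {p = _ ∷ _} {y = zero} ()
x∈p-y⇒x≢y {x = suc x} {p = _ ∷ _} {y = suc y} (there x∈p-y) refl =
  x∈p-y⇒x≢y x∈p-y refl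

x∉p-x : x ∉ p - x
x∉p-x x∈p-x = x∈p-y⇒x≢y x∈p-x refl

x∉p⇒p-x≡p : x ∉ p → p - x ≡ p
x∉p⇒p-x≡p {p = p} x∉p =
  ⊆-antisym (p─q⊆p p _) (λ y∈p → x∈p∧x≢y⇒x∈p-y y∈p λ { refl → x∉p y∈p })

x∈p∧x≢y∧p-y⊆q-y⇒x∈q : p - y ⊆ q - y → x ∈ p → x ≢ y → x ∈ q
x∈p∧x≢y∧p-y⊆q-y⇒x∈q {q = q} p-y⊆q-y x∈p x≢y =
  p─q⊆p q _ (p-y⊆q-y (x∈p∧x≢y⇒x∈p-y x∈p x≢y))

p-x⊆q-x⇒p⊆q : (x ∈ p → x ∈ q) → p - x ⊆ q - x → p ⊆ q
p-x⊆q-x⇒p⊆q {x = x} x∈p⇒x∈q p-x⊆q-x {y} y∈p with y ≟ x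
... | yes refl = x∈p⇒x∈q y∈p
... | no y≢x = x∈p∧x≢y∧p-y⊆q-y⇒x∈q p-x⊆q-x y∈p y≢x

p-x≡q-x⇒p≡q : x ∈ p ⇔ x ∈ q → p - x ≡ q - x → p ≡ q
p-x≡q-x⇒p≡q x∈p⇔x∈q p-x≡q-x = ⊆-antisym
  (p-x⊆q-x⇒p⊆q (Equivalence.to x∈p⇔x∈q) (⊆-reflexive p-x≡q-x))
  (p-x⊆q-x⇒p⊆q (Equivalence.from x∈p⇔x∈q) (⊆-reflexive (sym p-x≡q-x)))

≡⁅x⁆ : x ∈ p → (∀ {y} → y ∈ p → y ≡ x) → p ≡ ⁅ x ⁆
≡⁅x⁆ {x = x} {p = p} x∈p only-x = ⊆-antisym
  (λ y∈p → subst (_∈ ⁅ x ⁆) (sym (only-x y∈p)) (x∈⁅x⁆ x))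
  (λ y∈⁅x⁆ → subst (_∈ p) (sym (x∈⁅y⁆⇒x≡y x y∈⁅x⁆)) x∈p)

≡⁅x⁆∪⁅y⁆ : x ∈ p → y ∈ p → (∀ {z} → z ∈ p → z ≡ x ⊎ z ≡ y) → p ≡ ⁅ x ⁆ ∪ ⁅ y ⁆
≡⁅x⁆∪⁅y⁆ {x = x} {p = p} {y = y} x∈p y∈p only-x-y = ⊆-antisym
  (λ z∈p → [ (λ { refl → x∈p∪q⁺ (inj₁ (x∈⁅x⁆ x)) })
           , (λ { refl → x∈p∪q⁺ (inj₂ (x∈⁅x⁆ y)) }) ] (only-x-y z∈p))
  (λ z∈⁅x⁆∪⁅y⁆ → [ (λ z∈⁅x⁆ → subst (_∈ p) (sym (x∈⁅y⁆⇒x≡y x z∈⁅x⁆)) x∈p)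
                 , (λ z∈⁅y⁆ → subst (_∈ p) (sym (x∈⁅y⁆⇒x≡y y z∈⁅y⁆)) y∈p) ]
                 (x∈p∪q⁻ ⁅ x ⁆ ⁅ y ⁆ z∈⁅x⁆∪⁅y⁆))

⁅x⁆-x≡⊥ : ∀ (x : Fin n) → ⁅ x ⁆ - x ≡ ⊥
⁅x⁆-x≡⊥ x = Empty-unique λ (y , y∈⁅x⁆-x) →
  x∈p-y⇒x≢y y∈⁅x⁆-x (x∈⁅y⁆⇒x≡y x (p─q⊆p ⁅ x ⁆ _ y∈⁅x⁆-x))

⁅x⁆∪⁅y⁆-x≡⁅y⁆ : x ≢ y → (⁅ x ⁆ ∪ ⁅ y ⁆) - x ≡ ⁅ y ⁆
⁅x⁆∪⁅y⁆-x≡⁅y⁆ {x = x} {y = y} x≢y =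
  ≡⁅x⁆ (x∈p∧x≢y⇒x∈p-y (x∈p∪q⁺ (inj₂ (x∈⁅x⁆ y))) (x≢y ∘ sym)) only-y
  where
  only-y : ∀ {z} → z ∈ (⁅ x ⁆ ∪ ⁅ y ⁆) - x → z ≡ y
  only-y z∈ = [ (λ z∈⁅x⁆ → ⊥-elim (x∈p-y⇒x≢y z∈ (x∈⁅y⁆⇒x≡y x z∈⁅x⁆)))
              , x∈⁅y⁆⇒x≡y y ]
              (x∈p∪q⁻ ⁅ x ⁆ ⁅ y ⁆ (p─q⊆p _ _ z∈))

Disjoint : Subset n → Subset n → Set
Disjoint p q = ∀ {x} → x ∈ p → x ∉ q

Disjoint-sym : Symmetric (Disjoint {n})
Disjoint-sym p⊥q x∈q x∈p = p⊥q x∈p x∈q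

private
  variable
    P Q T : List (Subset n)

Partitions⇒disjoint : Partitions P → AllPairs Disjoint P
Partitions⇒disjoint {P = P} partP =
  subst (AllPairs Disjoint) (tabulate-lookup P) (tabulate⁺ apart)
  where
  apart : ∀ {i j} → i ≢ j → Disjoint (lookup P i) (lookup P j)
  apart {i} {j} i≢j {x} x∈Pᵢ x∈Pⱼ with _ , _ , unique ← partP x =
    i≢j (trans (unique i x∈Pᵢ) (sym (unique j x∈Pⱼ)))

Partitions⇒part-containing : Partitions P → ∀ x →
  ∃₂ λ p P′ → x ∈ p × P ↭ p ∷ P′
Partitions⇒part-containing partP x with i , x∈Pᵢ , _ ← partP x
  with P′ , P↭ ← ∈⇒↭∷ (∈-lookup i) = _ , P′ , x∈Pᵢ , P↭

minus-fresh : All (x ∉_) P → P minus x ≡ P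
minus-fresh []              = refl
minus-fresh (x∉p ∷ x∉parts) = cong₂ _∷_ (x∉p⇒p-x≡p x∉p) (minus-fresh x∉parts)

minus-own-part : AllPairs Disjoint P → P ↭ p ∷ T → x ∈ p → P minus x ↭ (p - x) ∷ T
minus-own-part {p = p} {T = T} {x = x} disjP P↭ x∈p
  with p⊥T ∷ _ ← AllPairs-resp-↭ Disjoint-sym P↭ disjP =
  subst (λ T′ → _ ↭ (p - x) ∷ T′)
        (minus-fresh (All.map (λ p⊥S → p⊥S x∈p) p⊥T))
        (map⁺ (_- x) P↭)

record Move (v : Fin n) (P Q : List (Subset n)) : Set where
  field
    source target : Subset n
    rest          : List (Subset n)
    v∈source      : v ∈ source
    v∈target      : v ∈ target
    P↭            : P ↭ source ∷ (target - v) ∷ rest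
    Q↭            : Q ↭ target ∷ (source - v) ∷ rest

Move-sym : Move v P Q → Move v Q P
Move-sym m = record
  { source = target ; target = source ; rest = rest
  ; v∈source = v∈target ; v∈target = v∈source ; P↭ = Q↭ ; Q↭ = P↭ }
  where open Move m

Move⇒↭ : (m : Move v P Q) → Move.source m ≡ Move.target m → P ↭ Q
Move⇒↭ record { P↭ = P↭ ; Q↭ = Q↭ } refl = ↭-trans P↭ (↭-sym Q↭)

minus-↭⇒Move : Partitions P → Partitions Q → P minus v ↭ Q minus v →
  P ↭ Q ⊎ Move v P Q
minus-↭⇒Move {v = v} partP partQ P-v↭Q-v
  with p , P′ , v∈p , P↭ ← Partitions⇒part-containing partP v
     | q , Q′ , v∈q , Q↭ ← Partitions⇒part-containing partQ v
  with ∷-↭-∷⁻ (↭-trans (↭-sym (minus-own-part (Partitions⇒disjoint partP) P↭ v∈p))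
              (↭-trans P-v↭Q-v (minus-own-part (Partitions⇒disjoint partQ) Q↭ v∈q)))
... | inj₁ (p-v≡q-v , P′↭Q′)
  with refl ← p-x≡q-x⇒p≡q (mk⇔ (const v∈q) (const v∈p)) p-v≡q-v =
  inj₁ (↭-trans P↭ (↭-trans (prep p P′↭Q′) (↭-sym Q↭)))
... | inj₂ (T , P′↭ , Q′↭) = inj₂ record
  { source = p ; target = q ; rest = T ; v∈source = v∈p ; v∈target = v∈q
  ; P↭ = ↭-trans P↭ (prep p P′↭) ; Q↭ = ↭-trans Q↭ (prep q Q′↭) }

Move⇒source-w≡target-w : v ≢ w → (m : Move v P Q) → P minus w ↭ Q minus w →
  Move.source m - w ≡ Move.target m - w
Move⇒source-w≡target-w {v = v} {w = w} v≢w
  record { source = p ; rest = T ; v∈source = v∈p ; P↭ = P↭ ; Q↭ = Q↭ } P-w↭Q-w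
  with pair-↭-pair⁻ (++-cancelʳ (T minus w)
         (↭-trans (↭-sym (map⁺ (_- w) P↭)) (↭-trans P-w↭Q-w (map⁺ (_- w) Q↭))))
... | inj₁ (p-w≡q-w , _) = p-w≡q-w
... | inj₂ (p-w≡p-v-w , _) =
  ⊥-elim (x∉p-x (p─q⊆p (p - v) _ (subst (v ∈_) p-w≡p-v-w (x∈p∧x≢y⇒x∈p-y v∈p v≢w))))

Merged : Fin n → Fin n → List (Subset n) → List (Subset n) → List (Subset n) → Set
Merged v w P Q R = P ↭ (⁅ v ⁆ ∪ ⁅ w ⁆) ∷ ⊥ ∷ R × Q ↭ ⁅ v ⁆ ∷ ⁅ w ⁆ ∷ R

pair-and-singleton : v ∈ p → w ∈ p → v ∈ q → w ∉ q → p - w ≡ q - w →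
  Disjoint p (q - v) → p ≡ ⁅ v ⁆ ∪ ⁅ w ⁆ × q ≡ ⁅ v ⁆
pair-and-singleton {v = v} {p = p} {w = w} {q = q} v∈p w∈p v∈q w∉q p-w≡q-w p⊥q-v =
  ≡⁅x⁆∪⁅y⁆ v∈p w∈p only-v-w , ≡⁅x⁆ v∈q only-v
  where
  only-v : ∀ {x} → x ∈ q → x ≡ v
  only-v {x} x∈q with x ≟ v
  ... | yes x≡v = x≡v
  ... | no x≢v = ⊥-elim (p⊥q-v x∈p (x∈p∧x≢y⇒x∈p-y x∈q x≢v))
    where
    x∈p : x ∈ p
    x∈p = x∈p∧x≢y∧p-y⊆q-y⇒x∈q (⊆-reflexive (sym p-w≡q-w)) x∈q λ { refl → w∉q x∈q }
  only-v-w : ∀ {x} → x ∈ p → x ≡ v ⊎ x ≡ w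
  only-v-w {x} x∈p with x ≟ w
  ... | yes x≡w = inj₂ x≡w
  ... | no x≢w = inj₁ (only-v (x∈p∧x≢y∧p-y⊆q-y⇒x∈q (⊆-reflexive p-w≡q-w) x∈p x≢w))

Move⇒Merged : AllPairs Disjoint P → v ≢ w → (m : Move v P Q) →
  w ∈ Move.source m → w ∉ Move.target m → Move.source m - w ≡ Move.target m - w →
  Merged v w P Q (Move.rest m)
Move⇒Merged {P = P} {v = v} {w = w} {Q = Q} disjP v≢w
  record { source = p ; target = q ; rest = T ; v∈source = v∈p ; v∈target = v∈q
         ; P↭ = P↭ ; Q↭ = Q↭ }
  w∈p w∉q p-w≡q-w
  with (p⊥q-v ∷ _) ∷ _ ← AllPairs-resp-↭ Disjoint-sym P↭ disjP
  with refl , refl ← pair-and-singleton v∈p w∈p v∈q w∉q p-w≡q-w p⊥q-v =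
    subst (λ S → P ↭ (⁅ v ⁆ ∪ ⁅ w ⁆) ∷ S ∷ T) (⁅x⁆-x≡⊥ v) P↭
  , subst (λ S → Q ↭ ⁅ v ⁆ ∷ S ∷ T) (⁅x⁆∪⁅y⁆-x≡⁅y⁆ v≢w) Q↭

Move⇒↭⊎Merged : AllPairs Disjoint P → AllPairs Disjoint Q → v ≢ w → Move v P Q →
  P minus w ↭ Q minus w → P ↭ Q ⊎ ∃ λ R → Merged v w P Q R ⊎ Merged v w Q P R
Move⇒↭⊎Merged {w = w} disjP disjQ v≢w m P-w↭Q-w
  with w ∈? Move.source m | w ∈? Move.target m | Move⇒source-w≡target-w v≢w m P-w↭Q-w
... | yes w∈p | yes w∈q | p-w≡q-w =
  inj₁ (Move⇒↭ m (p-x≡q-x⇒p≡q (mk⇔ (const w∈q) (const w∈p)) p-w≡q-w))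
... | no w∉p  | no w∉q  | p-w≡q-w =
  inj₁ (Move⇒↭ m (p-x≡q-x⇒p≡q (mk⇔ (⊥-elim ∘ w∉p) (⊥-elim ∘ w∉q)) p-w≡q-w))
... | yes w∈p | no w∉q  | p-w≡q-w =
  inj₂ (_ , inj₁ (Move⇒Merged disjP v≢w m w∈p w∉q p-w≡q-w))
... | no w∉p  | yes w∈q | p-w≡q-w =
  inj₂ (_ , inj₂ (Move⇒Merged disjQ v≢w (Move-sym m) w∈q w∉p (sym p-w≡q-w)))

stable-pair-part : ∀ {G : Graph n} {k R} → StablePartition G k P →
  P ↭ (⁅ v ⁆ ∪ ⁅ w ⁆) ∷ ⊥ ∷ R →
  ¬ Adj G v w × length R + 2 ≡ k × All (Independent G) R
stable-pair-part {v = v} {w = w} {R = R} (|P|≡k , indP , _) P↭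
  with ind-vw ∷ _ ∷ indR ← All-resp-↭ P↭ indP =
    ind-vw v w (x∈p∪q⁺ (inj₁ (x∈⁅x⁆ v))) (x∈p∪q⁺ (inj₂ (x∈⁅x⁆ w)))
  , trans (+-comm (length R) 2) (trans (sym (↭-length P↭)) |P|≡k)
  , indR

lemma2p5 : ∀ {n : ℕ} (G : Graph n) (k : ℕ) → 1 ≤ k →
    (P Q : List (Subset n)) → StablePartition G k P → StablePartition G k Q →
    ¬ (P ↭ Q) →
    (v w : Fin n) → ¬ (v ≡ w) →
    (P minus v) ↭ (Q minus v) → (P minus w) ↭ (Q minus w) →
    ¬ Adj G v w ×
    Σ (List (Subset n)) λ R → (length R + 2 ≡ k) × All (Independent G) R ×
      (((P ↭ ((⁅ v ⁆ ∪ ⁅ w ⁆) ∷ ⊥ ∷ R)) × (Q ↭ (⁅ v ⁆ ∷ ⁅ w ⁆ ∷ R)))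
      ⊎ ((Q ↭ ((⁅ v ⁆ ∪ ⁅ w ⁆) ∷ ⊥ ∷ R)) × (P ↭ (⁅ v ⁆ ∷ ⁅ w ⁆ ∷ R))))
lemma2p5 G k _ P Q stableP@(_ , _ , partP) stableQ@(_ , _ , partQ) P≁Q v w v≢w
  P-v↭Q-v P-w↭Q-w
  with minus-↭⇒Move partP partQ P-v↭Q-v
... | inj₁ P↭Q = ⊥-elim (P≁Q P↭Q)
... | inj₂ m
  with Move⇒↭⊎Merged (Partitions⇒disjoint partP) (Partitions⇒disjoint partQ) v≢w m P-w↭Q-w
... | inj₁ P↭Q = ⊥-elim (P≁Q P↭Q)
... | inj₂ (R , inj₁ merged@(P↭ , _))
  with ¬adj , |R|+2≡k , indR ← stable-pair-part {G = G} {k = k} stableP P↭ =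
  ¬adj , R , |R|+2≡k , indR , inj₁ merged
... | inj₂ (R , inj₂ merged@(Q↭ , _))
  with ¬adj , |R|+2≡k , indR ← stable-pair-part {G = G} {k = k} stableQ Q↭ =
  ¬adj , R , |R|+2≡k , indR , inj₂ merged
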